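{- Let $1\le k<n$. Consider vectors $P=(P_{K(i,j)})_{1\le i\le k,\ k+1\le j\le n}\in\mathbb{R}^{k(n-k)}$, together with the convention $P_{\{1,\dots,k\}}=0$. Define, for $1\le i\le k$ and $k+1\le j\le n$, \[\mathrm{Trop}\Psi(P)_{(i,j)}=\bigl(P_{K(i,j)}+P_{K(i+1,j-2)}+P_{K(i+2,j-1)}\bigr)-\bigl(P_{K(i,j-1)}+P_{K(i+1,j)}+P_{K(i+2,j-2)}\bigr).\] Then the map $P\mapsto(\mathrm{Trop}\Psi(P)_{(i,j)})_{1\le i\le k,\,k+1\le j\le n}$ is an injective map from $\mathbb{R}^{k(n-k)}$ to $\mathbb{R}^{k(n-k)}$.
   Context: For $1\le i\le k$ and $k+1\le j\le n$, $K(i,j)=\{1,\dots,i-1\}\cup\{i+j-k,\dots,j-1,j\}$, a $k$-element subset of $[n]$. For pairs $(i,j)$ outside this range (i.e. $i>k$ or $j<k+1$), one sets $K(i,j)=\{1,2,\dots,k\}$, so that $P_{K(i,j)}=P_{\{1,\dots,k\}}=0$. -}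

module Defs where

open import Level using (Level)
open import Algebra.Bundles using (CommutativeRing)
open import Data.Nat using (ℕ; zero; suc; _∸_; _≤?_; _<?_) renaming (_+_ to _+ℕ_)
open import Data.Fin using (Fin; toℕ; fromℕ<)
open import Relation.Nullary using (yes; no)

module _ {c ℓ : Level} (R : CommutativeRing c ℓ) where
  open CommutativeRing R

  -- A vector P ∈ R^{k(n-k)} is a function of (i,j) with 1 ≤ i ≤ k,
  -- k+1 ≤ j ≤ n, encoded as  P a b  with  i = 1 + toℕ a,  j = k + 1 + toℕ b.
  Coords : ℕ → ℕ → Set c
  Coords k n = Fin k → Fin (n ∸ k) → Carrier

  -- P_{K(i,j)} for arbitrary (1-based) natural indices i j, using the
  -- convention that K(i,j) = {1,…,k} (hence P_{K(i,j)} = 0) whenever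
  -- (i,j) lies outside the range 1 ≤ i ≤ k, k+1 ≤ j ≤ n.
  PK : (k n : ℕ) → Coords k n → ℕ → ℕ → Carrier
  PK k n P zero j = 0#
  PK k n P (suc i') j with i' <? k | suc k ≤? j | (j ∸ suc k) <? (n ∸ k)
  ... | yes p | yes _ | yes q = P (fromℕ< p) (fromℕ< q)
  ... | _     | _     | _     = 0#

  -- Trop Ψ(P)_{(i,j)}, for i = 1 + toℕ a, j = k + 1 + toℕ b.
  -- (j ≥ k+1 ≥ 2, so the truncated subtractions j ∸ 1, j ∸ 2 are exact.)
  TropΨ : (k n : ℕ) → Coords k n → Coords k n
  TropΨ k n P a b =
    (PK k n P i j + PK k n P (i +ℕ 1) (j ∸ 2) + PK k n P (i +ℕ 2) (j ∸ 1))
    + - (PK k n P i (j ∸ 1) + PK k n P (i +ℕ 1) j + PK k n P (i +ℕ 2) (j ∸ 2))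
    where
      i = suc (toℕ a)
      j = suc k +ℕ toℕ b

-- Δ f i j involves f i j, the entry to its left in row i, and entries of rows i+1 and i+2
-- only.  Since the grid of P vanishes outside the box, two grids with the same Δ on the box
-- agree row by row, from the last row downwards and left to right within a row: each entry
-- is recovered from Δ by cancelling already known terms.

module Submission where

open import Defs
open import Algebra.Bundles using (AbelianGroup; CommutativeRing)
import Algebra.Properties.Group as GroupProperties
open import Data.Nat using (ℕ; zero; suc; _∸_; _≤_; _<_; _≤?_; _<?_; z≤n; s≤s)
  renaming (_+_ to _+ℕ_)
open import Data.Nat.Properties
  using (≤-trans; ≤-reflexive; +-monoʳ-≤; m≤m+n; +-suc; ≤⇒≯; ≰⇒>; ∸-monoˡ-<; ∸-monoˡ-≤;
         m+[n∸m]≡n; m+n∸m≡n)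
open import Data.Fin using (Fin; toℕ; fromℕ<)
open import Data.Fin.Properties using (toℕ-fromℕ<; fromℕ<-toℕ; toℕ-injective; toℕ<n)
open import Data.Product using (∃₂; _×_; _,_)
open import Data.Sum using (_⊎_; inj₁; inj₂)
open import Data.Empty using (⊥-elim)
open import Relation.Nullary using (yes; no)
open import Relation.Binary.PropositionalEquality as ≡ using (_≡_)

module GridDifference {c ℓ} (G : AbelianGroup c ℓ) where
  open AbelianGroup G
  open GroupProperties group using (∙-cancelʳ)

  Grid : Set c
  Grid = ℕ → ℕ → Carrier

  Δ : Grid → Grid
  Δ f i j = (f i j ∙ f (i +ℕ 1) (j ∸ 2) ∙ f (i +ℕ 2) (j ∸ 1))
          ∙ (f i (j ∸ 1) ∙ f (i +ℕ 1) j ∙ f (i +ℕ 2) (j ∸ 2)) ⁻¹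

  Outside : ℕ → ℕ → ℕ → ℕ → Set
  Outside k n i j = k ≤ i ⊎ j ≤ k ⊎ n < j

  ∙-cancelʳ-≈ : ∀ {x x′ y y′} → x ∙ y ≈ x′ ∙ y′ → y ≈ y′ → x ≈ x′
  ∙-cancelʳ-≈ {y = y} x∙y≈x′∙y′ y≈y′ =
    ∙-cancelʳ y _ _ (trans x∙y≈x′∙y′ (∙-congˡ (sym y≈y′)))

  Δ-determines-corner : ∀ {f g : Grid} {i j} → Δ f i j ≈ Δ g i j →
    f (i +ℕ 1) (j ∸ 2) ≈ g (i +ℕ 1) (j ∸ 2) → f (i +ℕ 2) (j ∸ 1) ≈ g (i +ℕ 2) (j ∸ 1) →
    f i (j ∸ 1) ≈ g i (j ∸ 1) → f (i +ℕ 1) j ≈ g (i +ℕ 1) j → f (i +ℕ 2) (j ∸ 2) ≈ g (i +ℕ 2) (j ∸ 2) →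
    f i j ≈ g i j
  Δ-determines-corner Δ≈ a≈ b≈ c≈ d≈ e≈ =
    ∙-cancelʳ-≈ (∙-cancelʳ-≈ (∙-cancelʳ-≈ Δ≈ (⁻¹-cong (∙-cong (∙-cong c≈ d≈) e≈))) b≈) a≈

  module _ (k n : ℕ) {f g : Grid}
           (outside : ∀ i j → Outside k n i j → f i j ≈ g i j)
           (Δ≈ : ∀ i j → i < k → k < j → j ≤ n → Δ f i j ≈ Δ g i j) where

    RowAgrees : ℕ → Set ℓ
    RowAgrees i = ∀ j → f i j ≈ g i j

    row-agrees : ∀ {i} → i < k → RowAgrees (i +ℕ 1) → RowAgrees (i +ℕ 2) → RowAgrees i
    row-agrees {i} i<k row₁ row₂ = go
      where
        go : RowAgrees i
        go zero = outside i zero (inj₂ (inj₁ z≤n))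
        go (suc j) with suc j ≤? k | suc j ≤? n
        ... | yes j<k | _     = outside i (suc j) (inj₂ (inj₁ j<k))
        ... | no  _   | no j>n = outside i (suc j) (inj₂ (inj₂ (≰⇒> j>n)))
        ... | no  j≥k | yes j≤n =
          Δ-determines-corner {f} {g} (Δ≈ i (suc j) i<k (≰⇒> j≥k) j≤n)
            (row₁ _) (row₂ _) (go j) (row₁ _) (row₂ _)

    rows-agree : ∀ d i → k ≤ d +ℕ i → RowAgrees i
    rows-agree zero    i k≤i = λ j → outside i j (inj₁ k≤i)
    rows-agree (suc d) i k≤d+i with k ≤? i
    ... | yes k≤i = λ j → outside i j (inj₁ k≤i)
    ... | no  i<k = row-agrees (≰⇒> i<k) (rows-agree d (i +ℕ 1) (k≤d+[i+1+m] 0))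
                                         (rows-agree d (i +ℕ 2) (k≤d+[i+1+m] 1))
      where
        k≤d+[i+1+m] : ∀ m → k ≤ d +ℕ (i +ℕ suc m)
        k≤d+[i+1+m] m = ≤-trans k≤d+i (≤-trans (s≤s (+-monoʳ-≤ d (m≤m+n i m)))
                    (≤-reflexive (≡.sym (≡.trans (≡.cong (d +ℕ_) (+-suc i m)) (+-suc d (i +ℕ m))))))

    Δ-injective : ∀ i j → f i j ≈ g i j
    Δ-injective i = rows-agree k i (m≤m+n k i)

module _ {c ℓ} (R : CommutativeRing c ℓ) (k n : ℕ) where
  open CommutativeRing R using (_≈_; 0#; reflexive; +-abelianGroup)
  open GridDifference +-abelianGroup

  grid : Coords R k n → Grid
  grid X i = PK R k n X (suc i)

  grid-outside : ∀ X i j → Outside k n i j → grid X i j ≡ 0#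
  grid-outside X i j out with i <? k | suc k ≤? j | (j ∸ suc k) <? (n ∸ k)
  ... | no _    | _      | _     = ≡.refl
  ... | yes _   | no _   | _     = ≡.refl
  ... | yes _   | yes _  | no _  = ≡.refl
  ... | yes i<k | yes k<j | yes q with out
  ...   | inj₁ k≤i        = ⊥-elim (≤⇒≯ k≤i i<k)
  ...   | inj₂ (inj₁ j≤k) = ⊥-elim (≤⇒≯ j≤k k<j)
  ...   | inj₂ (inj₂ n<j) = ⊥-elim (≤⇒≯ (∸-monoˡ-≤ (suc k) n<j) q)

  grid-inside : ∀ X a b → grid X (toℕ a) (suc k +ℕ toℕ b) ≡ X a b
  grid-inside X a b
    with toℕ a <? k | suc k ≤? suc k +ℕ toℕ b | (suc k +ℕ toℕ b ∸ suc k) <? (n ∸ k)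
  ... | yes p | yes _ | yes q = ≡.cong₂ X (fromℕ<-toℕ a p)
                                  (toℕ-injective (≡.trans (toℕ-fromℕ< q) (m+n∸m≡n (suc k) (toℕ b))))
  ... | no a≮k | _     | _     = ⊥-elim (a≮k (toℕ<n a))
  ... | yes _  | no k≮j | _    = ⊥-elim (k≮j (m≤m+n (suc k) (toℕ b)))
  ... | yes _  | yes _ | no b≮ =
    ⊥-elim (b≮ (≡.subst (_< n ∸ k) (≡.sym (m+n∸m≡n (suc k) (toℕ b))) (toℕ<n b)))

  TropΨ≡Δ : ∀ X a b → TropΨ R k n X a b ≡ Δ (grid X) (toℕ a) (suc k +ℕ toℕ b)
  TropΨ≡Δ X a b = ≡.refl

  box-index : ∀ {i j} → i < k → k < j → j ≤ n →
    ∃₂ λ (a : Fin k) (b : Fin (n ∸ k)) → toℕ a ≡ i × suc k +ℕ toℕ b ≡ j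
  box-index {j = j} i<k k<j j≤n = fromℕ< i<k , fromℕ< q , toℕ-fromℕ< i<k ,
                          ≡.trans (≡.cong (suc k +ℕ_) (toℕ-fromℕ< q)) (m+[n∸m]≡n k<j)
    where
      q : j ∸ suc k < n ∸ k
      q = ∸-monoˡ-< (s≤s j≤n) k<j

  grids-agree-outside : ∀ X Y i j → Outside k n i j → grid X i j ≈ grid Y i j
  grids-agree-outside X Y i j out =
    reflexive (≡.trans (grid-outside X i j out) (≡.sym (grid-outside Y i j out)))

  Δ-grids-agree : ∀ {X Y} → (∀ a b → TropΨ R k n X a b ≈ TropΨ R k n Y a b) →
    ∀ i j → i < k → k < j → j ≤ n → Δ (grid X) i j ≈ Δ (grid Y) i j
  Δ-grids-agree {X} {Y} TropΨ≈ i j i<k k<j j≤n with box-index i<k k<j j≤n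
  ... | a , b , ≡.refl , ≡.refl =
    ≡.subst₂ _≈_ (TropΨ≡Δ X a b) (TropΨ≡Δ Y a b) (TropΨ≈ a b)

-- The bounds 1 ≤ k < n only make the box nonempty; injectivity holds without them.
lemma3p18 : ∀ {c ℓ} (R : CommutativeRing c ℓ) (k n : ℕ) → 1 ≤ k → k < n →
    (P Q : Coords R k n) →
    (∀ a b → CommutativeRing._≈_ R (TropΨ R k n P a b) (TropΨ R k n Q a b)) →
    ∀ a b → CommutativeRing._≈_ R (P a b) (Q a b)
lemma3p18 R k n _ _ P Q TropΨ≈ a b =
  ≡.subst₂ (CommutativeRing._≈_ R) (grid-inside R k n P a b) (grid-inside R k n Q a b)
    (GridDifference.Δ-injective (CommutativeRing.+-abelianGroup R) k n
      (grids-agree-outside R k n P Q) (Δ-grids-agree R k n TropΨ≈) (toℕ a) (suc k +ℕ toℕ b))
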